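{- There exists a family of strings $S_n$ ($n \geq 1$) over a binary alphabet with the following properties: $|S_n| = 2^{n+1}-1$; there exists an SLP of size $3n$ for $S_n$; and $H_k(S_n) \geq 2^{n-k}$ for all $1 \leq k < n$.
   Context: For a word $w=b_1\cdots b_N$ over a finite alphabet $\Sigma$, its unnormalized empirical entropy is $H(w)=-\sum_{i=1}^N\log_2(|w|_{b_i}/N)$, where $|w|_b$ is the number of occurrences of $b$ in $w$, and $H(\varepsilon)=0$. For a nonempty string $\alpha$, $w(\alpha)$ is the string whose $i$th character is the character of $w$ immediately following the $i$th occurrence of $\alpha$ in $w$ (occurrences that are suffixes of $w$ contribute nothing). The $k$th-order empirical entropy is $H_k(w)=\sum_{\alpha\in\Sigma^k}H(w(\alpha))$. A straight-line program (SLP) for $w$ is a context-free grammar generating exactly the string $w$ (with acyclic rules, one rule per nonterminal); its size is the sum of the lengths of the right-hand sides of its rules. -}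

module Defs where

open import Data.Nat using (ℕ; zero; suc; _+_; _*_)
open import Data.Bool using (Bool; true; false; if_then_else_)
open import Data.Bool.Properties using (_≟_)
open import Data.List using (List; []; _∷_; length; map; concatMap; _++_)
open import Data.Nat.ListAction using (product)
open import Data.Maybe using (Maybe; just; nothing)
open import Data.Fin using (Fin)
open import Data.Sum using (_⊎_; inj₁; inj₂)
open import Data.Vec as Vec using (Vec)
open import Relation.Nullary using (yes; no)
open import Relation.Binary.PropositionalEquality using (_≡_)

count : Bool → List Bool → ℕ
count b [] = 0
count b (x ∷ xs) with b ≟ x
... | yes _ = suc (count b xs)
... | no  _ = count b xs

-- Since H(w) = -Σ_i log₂(|w|_{b_i}/N) = log₂( Π_i N / Π_i |w|_{b_i} ),
-- we represent 2^{H(w)} as the fraction  numH w / denH w  (both in ℕ).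
-- (For w = ε both are the empty product 1, matching H(ε) = 0.)
numH : List Bool → ℕ
numH w = product (map (λ _ → length w) w)

denH : List Bool → ℕ
denH w = product (map (λ b → count b w) w)

stripPrefix : List Bool → List Bool → Maybe (List Bool)
stripPrefix [] w = just w
stripPrefix (a ∷ as) [] = nothing
stripPrefix (a ∷ as) (x ∷ xs) with a ≟ x
... | yes _ = stripPrefix as xs
... | no  _ = nothing

-- w(α): characters immediately following each occurrence of α in w
-- (occurrences that are suffixes of w contribute nothing).
follow : List Bool → List Bool → List Bool
follow α [] = []
follow α (x ∷ xs) with stripPrefix α (x ∷ xs)
... | just (c ∷ _) = c ∷ follow α xs
... | just []      = follow α xs
... | nothing      = follow α xs

allWords : ℕ → List (List Bool)
allWords zero = [] ∷ []
allWords (suc k) = concatMap (λ w → (false ∷ w) ∷ (true ∷ w) ∷ []) (allWords k)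

-- H_k(w) = Σ_{α∈Σ^k} H(w(α)), so 2^{H_k(w)} = numHk k w / denHk k w.
numHk : ℕ → List Bool → ℕ
numHk k w = product (map (λ α → numH (follow α w)) (allWords k))

denHk : ℕ → List Bool → ℕ
denHk k w = product (map (λ α → denH (follow α w)) (allWords k))

-- An SLP with m nonterminals is a
-- sequence of rules; the rule of the (i+1)-th nonterminal has a right-hand
-- side over terminals (inj₁) and previously defined nonterminals (inj₂),
-- which guarantees acyclicity.  The start symbol is the last nonterminal.
data SLP : ℕ → Set where
  []  : SLP zero
  _▷_ : ∀ {m} → SLP m → List (Bool ⊎ Fin m) → SLP (suc m)

expand : ∀ {m} → SLP m → Vec (List Bool) m
expand [] = Vec.[]
expand (g ▷ rhs) = Vec._∷ʳ_ es (concatMap sym rhs)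
  where
    es = expand g
    sym : _ → List Bool
    sym (inj₁ b) = b ∷ []
    sym (inj₂ j) = Vec.lookup es j

generates : ∀ {m} → SLP (suc m) → List Bool → Set
generates (g ▷ rhs) w = Vec.last (expand (g ▷ rhs)) ≡ w

size : ∀ {m} → SLP m → ℕ
size [] = 0
size (g ▷ rhs) = size g + length rhs

{-# OPTIONS --safe #-}
-- Take S₀ = 0 and Sₙ₊₁ = Sₙ Sₙ 1; the rules Xₙ₊₁ → Xₙ Xₙ 1 give an SLP with three symbols per level.
-- The context α = 0 1ᵏ⁻¹ of length k is followed by both letters already in Sₖ (at the seam of its
-- two copies of Sₖ₋₁ and at its end), and Sₙ contains 2ⁿ⁻ᵏ disjoint copies of Sₖ, so each letter
-- follows α at least 2ⁿ⁻ᵏ times in Sₙ. A binary word in which both letters occur at least X times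
-- has entropy at least X, since every occurrence of the minority letter c contributes
-- log₂(N / |w|_c) ≥ 1; finally Hₖ(Sₙ) ≥ H(Sₙ(α)).
module Submission where

open import Defs
open import Data.Nat using (ℕ; suc; _+_; _*_; _∸_; _^_; _≤_; _<_)
open import Data.Bool using (Bool)
open import Data.List using (List; length)
open import Data.Product using (Σ; ∃; _×_)
open import Relation.Binary.PropositionalEquality using (_≡_)

open import Data.Nat using (zero; z≤n; s≤s)
open import Data.Nat.Properties
open import Data.Nat.Tactic.RingSolver using (solve-∀)
open import Data.Nat.ListAction using (product)
open import Data.Bool using (true; false)
open import Data.Bool.Properties using () renaming (_≟_ to _≟ᴮ_)
open import Data.List using ([]; _∷_; _++_; map; replicate; concatMap)
open import Data.List.Properties using (++-assoc; length-++; length-replicate)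
open import Data.List.Membership.Propositional using (_∈_)
open import Data.List.Relation.Unary.Any using (here; there)
open import Data.Maybe using (just; nothing)
open import Data.Product using (_,_)
open import Data.Sum using (inj₁; inj₂)
open import Data.Fin using (fromℕ)
open import Data.Vec as Vec using (Vec)
open import Data.Vec.Properties using (last-∷ʳ)
open import Relation.Nullary using (yes; no)
open import Relation.Binary.PropositionalEquality
  using (refl; sym; trans; cong; cong₂; subst; module ≡-Reasoning)
open import Algebra.Properties.CommutativeSemigroup *-commutativeSemigroup
  using (interchange; x∙yz≈y∙xz)

product-map-mono : ∀ {A : Set} (f g : A → ℕ) → (∀ x → f x ≤ g x) →
                   ∀ xs → product (map f xs) ≤ product (map g xs)
product-map-mono f g f≤g []       = ≤-refl
product-map-mono f g f≤g (x ∷ xs) = *-mono-≤ (f≤g x) (product-map-mono f g f≤g xs)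

*-product-map-mono-∈ : ∀ {A : Set} (f g : A → ℕ) (a : ℕ) {x : A} {xs : List A} →
                       (∀ y → f y ≤ g y) → a * f x ≤ g x → x ∈ xs →
                       a * product (map f xs) ≤ product (map g xs)
*-product-map-mono-∈ f g a {x} {x ∷ xs} f≤g af≤g (here refl) = begin
  a * (f x * product (map f xs))  ≡⟨ sym (*-assoc a (f x) _) ⟩
  a * f x * product (map f xs)    ≤⟨ *-mono-≤ af≤g (product-map-mono f g f≤g xs) ⟩
  g x * product (map g xs)        ∎
  where open ≤-Reasoning
*-product-map-mono-∈ f g a {_} {y ∷ xs} f≤g af≤g (there x∈xs) = begin
  a * (f y * product (map f xs))  ≡⟨ x∙yz≈y∙xz a (f y) _ ⟩
  f y * (a * product (map f xs))  ≤⟨ *-mono-≤ (f≤g y) (*-product-map-mono-∈ f g a f≤g af≤g x∈xs) ⟩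
  g y * product (map g xs)        ∎
  where open ≤-Reasoning

count-self : ∀ b w → count b (b ∷ w) ≡ suc (count b w)
count-self false w = refl
count-self true  w = refl

count-∷ : ∀ b x w → count b (x ∷ w) ≡ count b (x ∷ []) + count b w
count-∷ b x w with b ≟ᴮ x
... | yes _ = refl
... | no  _ = refl

count≤length : ∀ b w → count b w ≤ length w
count≤length b []      = z≤n
count≤length b (x ∷ w) with b ≟ᴮ x
... | yes _ = s≤s (count≤length b w)
... | no  _ = m≤n⇒m≤1+n (count≤length b w)

count-false+count-true : ∀ w → count false w + count true w ≡ length w
count-false+count-true []          = refl
count-false+count-true (false ∷ w) = cong suc (count-false+count-true w)
count-false+count-true (true ∷ w)  =
  trans (+-suc (count false w) (count true w)) (cong suc (count-false+count-true w))

minority-letter : ∀ w → Σ Bool λ c → 2 * count c w ≤ length w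
minority-letter w with ≤-total (count false w) (count true w)
... | inj₁ f≤t = false , (begin
  2 * count false w                ≡⟨ cong (count false w +_) (+-identityʳ _) ⟩
  count false w + count false w    ≤⟨ +-monoʳ-≤ (count false w) f≤t ⟩
  count false w + count true w     ≡⟨ count-false+count-true w ⟩
  length w                         ∎)
  where open ≤-Reasoning
... | inj₂ t≤f = true , (begin
  2 * count true w                 ≡⟨ cong (count true w +_) (+-identityʳ _) ⟩
  count true w + count true w      ≤⟨ +-monoˡ-≤ (count true w) t≤f ⟩
  count false w + count true w     ≡⟨ count-false+count-true w ⟩
  length w                         ∎)
  where open ≤-Reasoning

2^count*product≤product : ∀ (f : Bool → ℕ) (N : ℕ) (c : Bool) →
                          2 * f c ≤ N → (∀ b → f b ≤ N) → ∀ w →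
                          2 ^ count c w * product (map f w) ≤ product (map (λ _ → N) w)
2^count*product≤product f N c 2fc≤N f≤N []      = ≤-refl
2^count*product≤product f N c 2fc≤N f≤N (x ∷ w) with c ≟ᴮ x
... | yes refl = begin
  2 * 2 ^ count c w * (f c * product (map f w))  ≡⟨ interchange 2 (2 ^ count c w) (f c) _ ⟩
  2 * f c * (2 ^ count c w * product (map f w))  ≤⟨ *-mono-≤ 2fc≤N (2^count*product≤product f N c 2fc≤N f≤N w) ⟩
  N * product (map (λ _ → N) w)                  ∎
  where open ≤-Reasoning
... | no _ = begin
  2 ^ count c w * (f x * product (map f w))      ≡⟨ x∙yz≈y∙xz (2 ^ count c w) (f x) _ ⟩
  f x * (2 ^ count c w * product (map f w))      ≤⟨ *-mono-≤ (f≤N x) (2^count*product≤product f N c 2fc≤N f≤N w) ⟩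
  N * product (map (λ _ → N) w)                  ∎
  where open ≤-Reasoning

H≥min-count : ∀ X w → (∀ b → X ≤ count b w) → 2 ^ X * denH w ≤ numH w
H≥min-count X w X≤count with minority-letter w
... | c , 2c≤N = ≤-trans (*-monoˡ-≤ (denH w) (^-monoʳ-≤ 2 (X≤count c)))
  (2^count*product≤product (λ b → count b w) (length w) c 2c≤N (λ b → count≤length b w) w)

H≥0 : ∀ w → denH w ≤ numH w
H≥0 w = subst (_≤ numH w) (*-identityˡ (denH w)) (H≥min-count 0 w (λ _ → z≤n))

∈-allWords : ∀ α → α ∈ allWords (length α)
∈-allWords []      = here refl
∈-allWords (b ∷ α) = cons-∈ b (allWords (length α)) (∈-allWords α)
  where
  cons-∈ : ∀ b {α} ws → α ∈ ws → (b ∷ α) ∈ concatMap (λ w → (false ∷ w) ∷ (true ∷ w) ∷ []) ws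
  cons-∈ false (_ ∷ ws) (here refl) = here refl
  cons-∈ true  (_ ∷ ws) (here refl) = there (here refl)
  cons-∈ b     (_ ∷ ws) (there α∈ws) = there (there (cons-∈ b ws α∈ws))

Hk≥H-follow : ∀ a k w {α} → α ∈ allWords k →
              a * denH (follow α w) ≤ numH (follow α w) → a * denHk k w ≤ numHk k w
Hk≥H-follow a k w α∈Σᵏ bound = *-product-map-mono-∈ (λ α → denH (follow α w)) (λ α → numH (follow α w))
  a (λ α → H≥0 (follow α w)) bound α∈Σᵏ

stripPrefix-++ : ∀ α u v {t} → stripPrefix α u ≡ just t → stripPrefix α (u ++ v) ≡ just (t ++ v)
stripPrefix-++ []      u       v refl = refl
stripPrefix-++ (a ∷ α) []      v ()
stripPrefix-++ (a ∷ α) (x ∷ u) v eq with a ≟ᴮ x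
... | yes _ = stripPrefix-++ α u v eq
stripPrefix-++ (a ∷ α) (x ∷ u) v () | no _

stripPrefix-++-self : ∀ α t → stripPrefix α (α ++ t) ≡ just t
stripPrefix-++-self []          t = refl
stripPrefix-++-self (false ∷ α) t = stripPrefix-++-self α t
stripPrefix-++-self (true ∷ α)  t = stripPrefix-++-self α t

follow-match : ∀ α x w {c t} → stripPrefix α (x ∷ w) ≡ just (c ∷ t) → follow α (x ∷ w) ≡ c ∷ follow α w
follow-match α x w eq rewrite eq = refl

count-follow-∷ : ∀ b α x w → count b (follow α w) ≤ count b (follow α (x ∷ w))
count-follow-∷ b α x w with stripPrefix α (x ∷ w)
... | just (c ∷ _) rewrite count-∷ b c (follow α w) = m≤n+m _ _
... | just []      = ≤-refl
... | nothing      = ≤-refl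

count-follow-++ : ∀ b α u v → count b (follow α u) + count b (follow α v) ≤ count b (follow α (u ++ v))
count-follow-++ b α []      v = ≤-refl
count-follow-++ b α (x ∷ u) v with stripPrefix α (x ∷ u) in eq
... | just (c ∷ t)
  rewrite follow-match α x (u ++ v) (stripPrefix-++ α (x ∷ u) v eq)
        | count-∷ b c (follow α u) | count-∷ b c (follow α (u ++ v))
        | +-assoc (count b (c ∷ [])) (count b (follow α u)) (count b (follow α v))
  = +-monoʳ-≤ (count b (c ∷ [])) (count-follow-++ b α u v)
... | just [] = ≤-trans (count-follow-++ b α u v) (count-follow-∷ b α x (u ++ v))
... | nothing = ≤-trans (count-follow-++ b α u v) (count-follow-∷ b α x (u ++ v))

count-follow-occurrence : ∀ b α u r → 1 ≤ count b (follow α (u ++ α ++ b ∷ r))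
count-follow-occurrence b α u r = ≤-trans (occurrence α)
  (≤-trans (m≤n+m _ _) (count-follow-++ b α u (α ++ b ∷ r)))
  where
  occurrence : ∀ α → 1 ≤ count b (follow α (α ++ b ∷ r))
  occurrence [] rewrite count-self b (follow [] r) = s≤s z≤n
  occurrence (a ∷ α)
    rewrite follow-match (a ∷ α) a (α ++ b ∷ r) (stripPrefix-++-self (a ∷ α) (b ∷ r))
          | count-self b (follow (a ∷ α) (α ++ b ∷ r)) = s≤s z≤n

S : ℕ → List Bool
S zero    = false ∷ []
S (suc n) = S n ++ (S n ++ true ∷ [])

suc-length-S : ∀ n → suc (length (S n)) ≡ 2 ^ suc n
suc-length-S zero    = refl
suc-length-S (suc n) = begin
  suc (length (S n ++ (S n ++ true ∷ [])))  ≡⟨ cong suc (trans (length-++ (S n)) (cong (ℓ +_) (length-++ (S n)))) ⟩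
  suc (ℓ + (ℓ + 1))                         ≡⟨ double-suc ℓ ⟩
  2 * suc ℓ                                 ≡⟨ cong (2 *_) (suc-length-S n) ⟩
  2 ^ suc (suc n)                           ∎
  where
  open ≡-Reasoning
  ℓ = length (S n)
  double-suc : ∀ m → suc (m + (m + 1)) ≡ 2 * suc m
  double-suc = solve-∀

length-S : ∀ n → length (S n) ≡ 2 ^ (n + 1) ∸ 1
length-S n = cong (_∸ 1) (trans (suc-length-S n) (cong (2 ^_) (+-comm 1 n)))

slp : ∀ n → SLP (suc n)
slp zero    = [] ▷ (inj₁ false ∷ inj₁ false ∷ inj₁ true ∷ [])
slp (suc n) = slp n ▷ (inj₂ (fromℕ n) ∷ inj₂ (fromℕ n) ∷ inj₁ true ∷ [])

lookup-fromℕ : ∀ {A : Set} {n} (xs : Vec A (suc n)) → Vec.lookup xs (fromℕ n) ≡ Vec.last xs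
lookup-fromℕ (x Vec.∷ Vec.[])     = refl
lookup-fromℕ (x Vec.∷ y Vec.∷ xs) = lookup-fromℕ (y Vec.∷ xs)

last-expand-slp : ∀ n → Vec.last (expand (slp n)) ≡ S (suc n)
last-expand-slp zero    = refl
last-expand-slp (suc n) = begin
  Vec.last (expand (slp n) Vec.∷ʳ (top ++ (top ++ true ∷ [])))  ≡⟨ last-∷ʳ _ (expand (slp n)) ⟩
  top ++ (top ++ true ∷ [])                                      ≡⟨ cong (λ s → s ++ (s ++ true ∷ [])) top≡S ⟩
  S (suc (suc n))                                                ∎
  where
  open ≡-Reasoning
  top = Vec.lookup (expand (slp n)) (fromℕ n)
  top≡S : top ≡ S (suc n)
  top≡S = trans (lookup-fromℕ (expand (slp n))) (last-expand-slp n)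

slp-generates-S : ∀ n → generates (slp n) (S (suc n))
slp-generates-S zero    = last-expand-slp zero
slp-generates-S (suc n) = last-expand-slp (suc n)

size-slp : ∀ n → size (slp n) ≡ 3 * suc n
size-slp zero    = refl
size-slp (suc n) = begin
  size (slp n) + 3  ≡⟨ cong (_+ 3) (size-slp n) ⟩
  3 * suc n + 3     ≡⟨ +-comm (3 * suc n) 3 ⟩
  3 + 3 * suc n     ≡⟨ sym (*-suc 3 (suc n)) ⟩
  3 * suc (suc n)   ∎
  where open ≡-Reasoning

count-follow-S-double : ∀ b α j → 2 * count b (follow α (S j)) ≤ count b (follow α (S (suc j)))
count-follow-S-double b α j = begin
  2 * c (S j)                      ≡⟨⟩
  c (S j) + (c (S j) + 0)          ≤⟨ +-monoʳ-≤ (c (S j)) (≤-trans (+-monoʳ-≤ (c (S j)) z≤n)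
                                                          (count-follow-++ b α (S j) (true ∷ []))) ⟩
  c (S j) + c (S j ++ true ∷ [])   ≤⟨ count-follow-++ b α (S j) (S j ++ true ∷ []) ⟩
  c (S (suc j))                    ∎
  where
  open ≤-Reasoning
  c : List Bool → ℕ
  c w = count b (follow α w)

count-follow-S-scale : ∀ b α d j → 2 ^ d * count b (follow α (S j)) ≤ count b (follow α (S (d + j)))
count-follow-S-scale b α zero    j = ≤-reflexive (*-identityˡ _)
count-follow-S-scale b α (suc d) j = begin
  2 * 2 ^ d * count b (follow α (S j))    ≡⟨ *-assoc 2 (2 ^ d) _ ⟩
  2 * (2 ^ d * count b (follow α (S j)))  ≤⟨ *-monoʳ-≤ 2 (count-follow-S-scale b α d j) ⟩
  2 * count b (follow α (S (d + j)))      ≤⟨ count-follow-S-double b α (d + j) ⟩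
  count b (follow α (S (suc d + j)))      ∎
  where open ≤-Reasoning

01ᵏ : ℕ → List Bool
01ᵏ k = false ∷ replicate k true

replicate-∷ʳ : ∀ {A : Set} j (x : A) → replicate j x ++ x ∷ [] ≡ x ∷ replicate j x
replicate-∷ʳ zero    x = refl
replicate-∷ʳ (suc j) x = cong (x ∷_) (replicate-∷ʳ j x)

S-head : ∀ j → ∃ λ r → S j ≡ false ∷ r
S-head zero    = [] , refl
S-head (suc j) with S-head j
... | r , eq = r ++ (S j ++ true ∷ []) , cong (_++ (S j ++ true ∷ [])) eq

S-tail : ∀ j → ∃ λ u → S j ≡ u ++ 01ᵏ j
S-tail zero    = [] , refl
S-tail (suc j) with S-tail j
... | u , eq = S j ++ u , (begin
  S j ++ (S j ++ true ∷ [])                        ≡⟨ cong (λ s → S j ++ (s ++ true ∷ [])) eq ⟩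
  S j ++ ((u ++ 01ᵏ j) ++ true ∷ [])               ≡⟨ cong (S j ++_) (++-assoc u (01ᵏ j) _) ⟩
  S j ++ (u ++ false ∷ (replicate j true ++ true ∷ []))
                                                   ≡⟨ cong (λ s → S j ++ (u ++ false ∷ s)) (replicate-∷ʳ j true) ⟩
  S j ++ (u ++ 01ᵏ (suc j))                        ≡⟨ sym (++-assoc (S j) u _) ⟩
  (S j ++ u) ++ 01ᵏ (suc j)                        ∎)
  where open ≡-Reasoning

-- 0 1ᵏ is followed by 0 where the two copies of S k meet, and by 1 at the very end.
S-∃-occurrence : ∀ k b → ∃ λ u → ∃ λ r → S (suc k) ≡ u ++ 01ᵏ k ++ b ∷ r
S-∃-occurrence k false with S-tail k | S-head k
... | u , tail | r , head = u , r ++ true ∷ [] , (begin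
  S k ++ (S k ++ true ∷ [])                    ≡⟨ cong₂ (λ s t → s ++ (t ++ true ∷ [])) tail head ⟩
  (u ++ 01ᵏ k) ++ (false ∷ r ++ true ∷ [])     ≡⟨ ++-assoc u (01ᵏ k) _ ⟩
  u ++ 01ᵏ k ++ false ∷ r ++ true ∷ []         ∎)
  where open ≡-Reasoning
S-∃-occurrence k true with S-tail k
... | u , tail = S k ++ u , [] , (begin
  S k ++ (S k ++ true ∷ [])                    ≡⟨ cong (λ s → S k ++ (s ++ true ∷ [])) tail ⟩
  S k ++ ((u ++ 01ᵏ k) ++ true ∷ [])           ≡⟨ cong (S k ++_) (++-assoc u (01ᵏ k) _) ⟩
  S k ++ (u ++ 01ᵏ k ++ true ∷ [])             ≡⟨ sym (++-assoc (S k) u _) ⟩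
  (S k ++ u) ++ 01ᵏ k ++ true ∷ []             ∎)
  where open ≡-Reasoning

count-follow-01ᵏ-S : ∀ b k n → suc k ≤ n → 2 ^ (n ∸ suc k) ≤ count b (follow (01ᵏ k) (S n))
count-follow-01ᵏ-S b k n k<n with S-∃-occurrence k b
... | u , r , S≡ = begin
  2 ^ d                     ≡⟨ sym (*-identityʳ _) ⟩
  2 ^ d * 1                 ≤⟨ *-monoʳ-≤ (2 ^ d) (subst (λ w → 1 ≤ c w) (sym S≡) (count-follow-occurrence b (01ᵏ k) u r)) ⟩
  2 ^ d * c (S (suc k))     ≤⟨ count-follow-S-scale b (01ᵏ k) d (suc k) ⟩
  c (S (d + suc k))         ≡⟨ cong (λ m → c (S m)) (m∸n+n≡m k<n) ⟩
  c (S n)                   ∎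
  where
  open ≤-Reasoning
  d = n ∸ suc k
  c : List Bool → ℕ
  c w = count b (follow (01ᵏ k) w)

01ᵏ∈allWords : ∀ k → 01ᵏ k ∈ allWords (suc k)
01ᵏ∈allWords k = subst (λ m → 01ᵏ k ∈ allWords (suc m)) (length-replicate k) (∈-allWords (01ᵏ k))

mainTheorem9 : Σ (ℕ → List Bool) λ S → (n : ℕ) → 1 ≤ n →
    (length (S n) ≡ 2 ^ (n + 1) ∸ 1)
    × (Σ ℕ λ m → Σ (SLP (suc m)) λ g → generates g (S n) × size g ≡ 3 * n)
    × ((k : ℕ) → 1 ≤ k → k < n → 2 ^ (2 ^ (n ∸ k)) * denHk k (S n) ≤ numHk k (S n))
mainTheorem9 = S , λ n 1≤n → length-S n , small-slp n 1≤n , entropy n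
  where
  small-slp : ∀ n → 1 ≤ n → Σ ℕ λ m → Σ (SLP (suc m)) λ g → generates g (S n) × size g ≡ 3 * n
  small-slp (suc n) _ = n , slp n , slp-generates-S n , size-slp n
  entropy : ∀ n k → 1 ≤ k → k < n → 2 ^ (2 ^ (n ∸ k)) * denHk k (S n) ≤ numHk k (S n)
  entropy n (suc k) _ k<n = Hk≥H-follow (2 ^ 2 ^ (n ∸ suc k)) (suc k) (S n) (01ᵏ∈allWords k)
    (H≥min-count (2 ^ (n ∸ suc k)) (follow (01ᵏ k) (S n)) (λ b → count-follow-01ᵏ-S b k n (<⇒≤ k<n)))
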